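{- Let $p<q$ be prime numbers, $N=pq$, and suppose $2p<q<3p$. Then: (1) $\frac{2p+q-1}{2}\in\mathbb{Z}\text{ - }\mathcal{KS}(N)$ if and only if $q-p+1\in\mathbb{Z}\text{ - }\mathcal{KS}(N)$; (2) if $3q-5p+3\in\mathbb{Z}\text{ - }\mathcal{KS}(N)$, then $q-p+1\in\mathbb{Z}\text{ - }\mathcal{KS}(N)$.
   Context: For a rational number $\alpha\neq 0$ write $\alpha=\frac{\alpha_1}{\alpha_2}$ with $\alpha_1,\alpha_2$ integers and $\gcd(\alpha_1,\alpha_2)=1$. An integer $N\ge 2$ is called an $\alpha$-Korselt number if $N\neq\alpha$ and $\alpha_2 r-\alpha_1$ divides $\alpha_2 N-\alpha_1$ (in $\mathbb{Z}$; $0$ divides only $0$) for every prime divisor $r$ of $N$. For a subset $\mathbb{A}\subseteq\mathbb{Q}$, $\mathbb{A}\text{ - }\mathcal{KS}(N)$ denotes the set of all $\beta\in\mathbb{A}\setminus\{0,N\}$ such that $N$ is a $\beta$-Korselt number. For an integer $\beta$ this means $r-\beta\mid N-\beta$ for every prime $r\mid N$. -}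

module Defs where

open import Data.Nat using (ℕ; _≤_)
open import Data.Nat.Primality using (Prime)
import Data.Nat.Divisibility as ℕD
open import Data.Integer using (ℤ; +_; _-_)
open import Data.Integer.Divisibility using (_∣_)
open import Relation.Binary.PropositionalEquality using (_≢_)
open import Data.Product using (_×_)

-- N is a β-Korselt number for an integer β (α₂ = 1, α₁ = β):
-- N ≥ 2, N ≠ β, and (r - β) ∣ (N - β) for every prime r ∣ N.
IsKorselt : ℕ → ℤ → Set
IsKorselt N β =
  (2 ≤ N) × (β ≢ + N) ×
  (∀ (r : ℕ) → Prime r → r ℕD.∣ N → (+ r - β) ∣ (+ N - β))

InZKS : ℤ → ℕ → Set
InZKS β N = (β ≢ + 0) × (β ≢ + N) × IsKorselt N β

module Submission where

-- Since q is an odd prime with 2p < q < 3p we can write q = 2p + 2d - 1 with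
-- 1 ≤ d < p (d = e + 1 below).  In these coordinates the three candidates are
--   β₁ = (2p + q - 1)/2 = 2p + d - 1,   β₂ = q - p + 1 = p + 2d,
--   β₃ = 3q - 5p + 3 = p + 6d.
-- For N = pq the Korselt condition at a prime factor r reads r - β ∣ N - β,
-- equivalently r - β ∣ N - r, because N - β = (N - r) + (r - β).  With
-- N - q = q(p-1) and N - p = 2p(p+d-1) this turns each condition into a
-- divisibility between natural numbers:
--   β₁ ∈ ℤ-KS(N)  ⇔  d ∣ q(p-1),     β₂ ∈ ℤ-KS(N)  ⇔  d ∣ p(p+d-1),
--   β₃ ∈ ℤ-KS(N)  ⇒  6d ∣ 2p(p+d-1)  ⇒  d ∣ p(p+d-1),
-- and as d is coprime to both primes p and q, both d ∣ q(p-1) and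
-- d ∣ p(p+d-1) are equivalent to d ∣ p-1.  The file first proves the general
-- facts (shifting the Korselt condition, Korselt numbers with two prime
-- factors, the odd excess of q over 2p), then the computation in the
-- coordinates (a, e) with p = a + 1, d = e + 1, and finally the proposition.

open import Defs
open import Data.Nat using (ℕ; _<_; _*_; _+_; _∸_; _/_)
open import Data.Nat.Primality using (Prime)
open import Data.Integer using (ℤ; +_; _-_)
open import Data.Product using (_×_)
open import Function.Bundles using (_⇔_)

open import Data.Nat using (zero; suc; _≤_; s≤s; z≤n; >-nonZero)
open import Data.Nat.Properties
open import Data.Nat.Tactic.RingSolver using (solve-∀)
open import Data.Nat.Primality using (prime[2]; ¬prime[0]; ¬prime[1]; prime⇒irreducible; euclidsLemma)
open import Data.Nat.Divisibility as ℕ using (divides; ∣-trans; m∣m*n; n∣m*n; ∣n⇒∣m*n; ∣m+n∣m⇒∣n; ∣m∣n⇒∣m+n)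
open import Data.Nat.Coprimality as Coprime using (coprime-divisor; prime⇒coprime)
open import Data.Nat.DivMod using (m*n/n≡m)
open import Data.Integer using (∣_∣)
import Data.Integer as ℤ
import Data.Integer.Properties as ℤP
open import Data.Integer.Divisibility using (_∣_)
import Data.Integer.Divisibility.Signed as Signed
import Data.Integer.Tactic.RingSolver as ℤ-Solver
open import Data.Product using (∃-syntax; _,_)
open import Data.Sum using (_⊎_; inj₁; inj₂)
open import Data.Empty using (⊥-elim)
open import Relation.Binary.PropositionalEquality
open import Function.Bundles using (mk⇔; Equivalence)
import Function.Properties.Equivalence as ⇔

open Equivalence using (to; from)

+-difference : ∀ m k → + (m + k) - + m ≡ + k
+-difference m k = begin
  + (m + k) - + m  ≡⟨ ℤP.[+m]-[+n]≡m⊖n (m + k) m ⟩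
  (m + k) ℤ.⊖ m    ≡⟨ ℤP.⊖-≥ (m≤m+n m k) ⟩
  + (m + k ∸ m)    ≡⟨ cong +_ (m+n∸m≡n m k) ⟩
  + k              ∎
  where open ≡-Reasoning

distance-above : ∀ r b {k} → r ≡ b + k → ∣ + r - + b ∣ ≡ k
distance-above _ b {k} refl = cong ∣_∣ (+-difference b k)

distance-below : ∀ r b {k} → b ≡ r + k → ∣ + r - + b ∣ ≡ k
distance-below r b b≡r+k =
  trans (ℤP.∣i-j∣≡∣j-i∣ (+ r) (+ b)) (distance-above b r b≡r+k)

-- The Korselt condition at r may be shifted: since z - y = (z - x) + (x - y),
-- x - y divides z - y exactly when it divides z - x.
korselt-shift : ∀ x y z → ((x - y) ∣ (z - y)) ⇔ ((x - y) ∣ (z - x))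
korselt-shift x y z = mk⇔
  (λ h → Signed.∣⇒∣ᵤ (Signed.∣m+n∣n⇒∣m {m = z - x} (signed h) Signed.∣-refl))
  (λ h → Signed.∣⇒∣ᵤ (subst (x - y Signed.∣_) (sym split)
                        (Signed.∣m∣n⇒∣m+n (Signed.∣ᵤ⇒∣ {i = z - x} h) Signed.∣-refl)))
  where
  split : z - y ≡ (z - x) ℤ.+ (x - y)
  split = identity x y z
    where identity : ∀ x y z → z - y ≡ (z - x) ℤ.+ (x - y)
          identity = ℤ-Solver.solve-∀
  signed : (x - y) ∣ (z - y) → (x - y) Signed.∣ ((z - x) ℤ.+ (x - y))
  signed h = subst (x - y Signed.∣_) split (Signed.∣ᵤ⇒∣ h)

korselt-condition : ∀ r b {M k s} → ∣ + r - + b ∣ ≡ k → M ≡ r + s →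
                    ((+ r - + b) ∣ (+ M - + b)) ⇔ (k ℕ.∣ s)
korselt-condition r b {M} {k} {s} refl refl = ⇔.trans (korselt-shift (+ r) (+ b) (+ M)) as-ℕ
  where
  as-ℕ : ((+ r - + b) ∣ (+ (r + s) - + r)) ⇔ (k ℕ.∣ s)
  as-ℕ = subst (λ z → ((+ r - + b) ∣ z) ⇔ (k ℕ.∣ s)) (sym (+-difference r s)) ⇔.refl

prime-divisor-of-prime : ∀ {p r} → Prime p → Prime r → r ℕ.∣ p → r ≡ p
prime-divisor-of-prime p-prime r-prime r∣p with prime⇒irreducible p-prime r∣p
... | inj₁ refl = ⊥-elim (¬prime[1] r-prime)
... | inj₂ r≡p   = r≡p

prime-factor-of-semiprime : ∀ {p q r} → Prime p → Prime q → Prime r →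
                            r ℕ.∣ p * q → r ≡ p ⊎ r ≡ q
prime-factor-of-semiprime {p} {q} p-prime q-prime r-prime r∣pq
  with euclidsLemma p q r-prime r∣pq
... | inj₁ r∣p = inj₁ (prime-divisor-of-prime p-prime r-prime r∣p)
... | inj₂ r∣q = inj₂ (prime-divisor-of-prime q-prime r-prime r∣q)

semiprime-korselt : ∀ {p q b} → Prime p → Prime q → 0 < b → b < p * q →
                    (+ p - + b) ∣ (+ (p * q) - + b) →
                    (+ q - + b) ∣ (+ (p * q) - + b) →
                    InZKS (+ b) (p * q)
semiprime-korselt {p} {q} {b} p-prime q-prime 0<b b<N at-p at-q =
  b≢0 , b≢N , 2≤N , b≢N , at-prime-factor
  where
  b≢0 : + b ≢ + 0
  b≢0 b≡0 = >⇒≢ 0<b (ℤP.+-injective b≡0)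
  b≢N : + b ≢ + (p * q)
  b≢N b≡N = <⇒≢ b<N (ℤP.+-injective b≡N)
  2≤N : 2 ≤ p * q
  2≤N = ≤-<-trans 0<b b<N
  at-prime-factor : ∀ r → Prime r → r ℕ.∣ p * q → (+ r - + b) ∣ (+ (p * q) - + b)
  at-prime-factor r r-prime r∣N with prime-factor-of-semiprime p-prime q-prime r-prime r∣N
  ... | inj₁ refl = at-p
  ... | inj₂ refl = at-q

korselt-at : ∀ {β N r} → InZKS β N → Prime r → r ℕ.∣ N → (+ r - β) ∣ (+ N - β)
korselt-at (_ , _ , _ , _ , condition) r-prime r∣N = condition _ r-prime r∣N

-- A number that is positive and below a prime r is coprime to r, so it may be
-- cancelled against the factor r.
coprime-cancel : ∀ {r d} x → Prime r → 0 < d → d < r → (d ℕ.∣ r * x) ⇔ (d ℕ.∣ x)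
coprime-cancel {r} {d} x r-prime 0<d d<r = mk⇔
  (coprime-divisor (Coprime.sym (prime⇒coprime r-prime {{>-nonZero 0<d}} d<r)))
  (∣n⇒∣m*n r)

parity : ∀ n → ∃[ k ] (n ≡ k + k ⊎ n ≡ suc (k + k))
parity zero = 0 , inj₁ refl
parity (suc n) with parity n
... | k , inj₁ n≡2k   = k , inj₂ (cong suc n≡2k)
... | k , inj₂ n≡2k+1 = suc k , inj₁ (cong suc (trans n≡2k+1 (sym (+-suc k k))))

excess-bound : ∀ p e → 2 * p + 2 * e + 1 < 3 * p → suc e < p
excess-bound p e q<3p = ≤-<-trans (s≤s (m≤m+n e e)) 2e+1<p
  where
  2e+1<p : suc (e + e) < p
  2e+1<p = +-cancelˡ-< (2 * p) (suc (e + e)) p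
             (subst₂ _<_ (identity₁ p e) (identity₂ p) q<3p)
    where
    identity₁ : ∀ p e → 2 * p + 2 * e + 1 ≡ 2 * p + suc (e + e)
    identity₁ = solve-∀
    identity₂ : ∀ p → 3 * p ≡ 2 * p + p
    identity₂ = solve-∀

-- An odd prime q with 2p < q < 3p has the form q = 2p + 2e + 1 with e + 1 < p;
-- q cannot be even, since the only even prime 2 is not larger than 2p.
odd-excess : ∀ {p q} → 0 < p → Prime q → 2 * p < q → q < 3 * p →
             ∃[ e ] (q ≡ 2 * p + 2 * e + 1 × suc e < p)
odd-excess {p} {q} 0<p q-prime 2p<q q<3p with m≤n⇒∃[o]m+o≡n 2p<q
... | o , 2p+1+o≡q with parity o
...   | e , inj₁ refl = e , q-form , excess-bound p e (subst (_< 3 * p) q-form q<3p)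
  where
  q-form : q ≡ 2 * p + 2 * e + 1
  q-form = trans (sym 2p+1+o≡q) (identity p e)
    where identity : ∀ p e → suc (2 * p) + (e + e) ≡ 2 * p + 2 * e + 1
          identity = solve-∀
...   | e , inj₂ refl = ⊥-elim (<⇒≱ (subst (2 * p <_) q≡2 2p<q) 2≤2p)
  where
  q≡2 : q ≡ 2
  q≡2 = sym (prime-divisor-of-prime q-prime prime[2] (divides (p + suc e) (trans (sym 2p+1+o≡q) (identity p e))))
    where identity : ∀ p e → suc (2 * p) + suc (e + e) ≡ (p + suc e) * 2
          identity = solve-∀
  2≤2p : 2 ≤ 2 * p
  2≤2p = *-monoʳ-≤ 2 0<p

divides-plus-self : ∀ {d} x → (d ℕ.∣ d + x) ⇔ (d ℕ.∣ x)
divides-plus-self x = mk⇔ (λ h → ∣m+n∣m⇒∣n h ℕ.∣-refl) (∣m∣n⇒∣m+n ℕ.∣-refl)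

halve : ∀ d x → (2 * d ℕ.∣ 2 * x) ⇔ (d ℕ.∣ x)
halve d x = mk⇔ (ℕ.*-cancelˡ-∣ 2) (ℕ.*-monoʳ-∣ 2)

-- The computation for p = a + 1 and q = 2p + 2e + 1, with d = e + 1 < p.
module Coordinates (a e : ℕ) (p-prime : Prime (suc a))
                   (q-prime : Prime (2 * suc a + 2 * e + 1)) (d<p : suc e < suc a) where

  p d q N β₁ β₂ β₃ : ℕ
  p  = suc a
  d  = suc e
  q  = 2 * p + 2 * e + 1
  N  = p * q
  β₁ = 2 * p + e
  β₂ = p + 2 * d
  β₃ = p + 6 * d

  N≡q+q·a : N ≡ q + q * a
  N≡q+q·a = cong (λ x → q + x) (*-comm a q)

  N≡p+2p[p+e] : N ≡ p + 2 * (p * (p + e))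
  N≡p+2p[p+e] = polynomial a e
    where polynomial : ∀ a e → suc a * (2 * suc a + 2 * e + 1) ≡ suc a + 2 * (suc a * (suc a + e))
          polynomial = solve-∀

  q≡β₁+d : q ≡ β₁ + d
  q≡β₁+d = polynomial a e
    where polynomial : ∀ a e → 2 * suc a + 2 * e + 1 ≡ (2 * suc a + e) + suc e
          polynomial = solve-∀

  β₁≡p+[p+e] : β₁ ≡ p + (p + e)
  β₁≡p+[p+e] = polynomial a e
    where polynomial : ∀ a e → 2 * suc a + e ≡ suc a + (suc a + e)
          polynomial = solve-∀

  q≡β₂+a : q ≡ β₂ + a
  q≡β₂+a = polynomial a e
    where polynomial : ∀ a e → 2 * suc a + 2 * e + 1 ≡ (suc a + 2 * suc e) + a
          polynomial = solve-∀

  0<d : 0 < d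
  0<d = s≤s z≤n

  0<a : 0 < a
  0<a = ≤-trans 0<d (≤-pred d<p)

  d<q : d < q
  d<q = subst (d <_) (sym q≡β₁+d) (m<n+m d (s≤s z≤n))

  below-N : ∀ {b k} → 0 < k → q ≡ b + k → b < N
  below-N {b} {k} 0<k q≡b+k = <-≤-trans b<q q≤N
    where
    b<q : b < q
    b<q = subst (b <_) (sym q≡b+k) (m<m+n b 0<k)
    q≤N : q ≤ N
    q≤N = subst (q ≤_) (sym N≡q+q·a) (m≤m+n q (q * a))

  -- Both conditions below are equivalent to d ∣ p - 1, as d is coprime to p and q.
  d∣q·a⇔d∣p·[p+e] : (d ℕ.∣ q * a) ⇔ (d ℕ.∣ p * (p + e))
  d∣q·a⇔d∣p·[p+e] = ⇔.trans d∣q·a⇔d∣a (⇔.sym (⇔.trans d∣p·[p+e]⇔d∣p+e d∣p+e⇔d∣a))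
    where
    d∣q·a⇔d∣a : (d ℕ.∣ q * a) ⇔ (d ℕ.∣ a)
    d∣q·a⇔d∣a = coprime-cancel a q-prime 0<d d<q
    d∣p·[p+e]⇔d∣p+e : (d ℕ.∣ p * (p + e)) ⇔ (d ℕ.∣ p + e)
    d∣p·[p+e]⇔d∣p+e = coprime-cancel (p + e) p-prime 0<d d<p
    d∣p+e⇔d∣a : (d ℕ.∣ p + e) ⇔ (d ℕ.∣ a)
    d∣p+e⇔d∣a = subst (λ x → (d ℕ.∣ x) ⇔ (d ℕ.∣ a)) (cong suc (+-comm e a)) (divides-plus-self a)

  β₁-membership : InZKS (+ β₁) N ⇔ (d ℕ.∣ q * a)
  β₁-membership = mk⇔
    (λ β₁∈KS → to at-q (korselt-at β₁∈KS q-prime (n∣m*n p)))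
    (λ d∣q·a → semiprime-korselt p-prime q-prime (s≤s z≤n) (below-N 0<d q≡β₁+d)
                 at-p (from at-q d∣q·a))
    where
    at-q : ((+ q - + β₁) ∣ (+ N - + β₁)) ⇔ (d ℕ.∣ q * a)
    at-q = korselt-condition q β₁ (distance-above q β₁ q≡β₁+d) N≡q+q·a
    at-p : (+ p - + β₁) ∣ (+ N - + β₁)
    at-p = from (korselt-condition p β₁ (distance-below p β₁ β₁≡p+[p+e]) N≡p+2p[p+e])
                (∣n⇒∣m*n 2 (n∣m*n p))

  β₂-membership : InZKS (+ β₂) N ⇔ (d ℕ.∣ p * (p + e))
  β₂-membership = mk⇔
    (λ β₂∈KS → to at-p (korselt-at β₂∈KS p-prime (m∣m*n q)))
    (λ d∣p·[p+e] → semiprime-korselt p-prime q-prime (s≤s z≤n) (below-N 0<a q≡β₂+a)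
                     (from at-p d∣p·[p+e]) at-q)
    where
    at-p : ((+ p - + β₂) ∣ (+ N - + β₂)) ⇔ (d ℕ.∣ p * (p + e))
    at-p = ⇔.trans (korselt-condition p β₂ (distance-below p β₂ refl) N≡p+2p[p+e]) (halve d (p * (p + e)))
    at-q : (+ q - + β₂) ∣ (+ N - + β₂)
    at-q = from (korselt-condition q β₂ (distance-above q β₂ q≡β₂+a) N≡q+q·a) (n∣m*n q)

  -- If β₃ is Korselt, then 6d ∣ 2p(p + d - 1) at p, hence d ∣ p(p + d - 1).
  β₃-membership : InZKS (+ β₃) N → d ℕ.∣ p * (p + e)
  β₃-membership β₃∈KS = to (halve d (p * (p + e))) (∣-trans 2d∣6d 6d∣2p[p+e])
    where
    6d∣2p[p+e] : 6 * d ℕ.∣ 2 * (p * (p + e))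
    6d∣2p[p+e] = to (korselt-condition p β₃ (distance-below p β₃ refl) N≡p+2p[p+e])
                    (korselt-at β₃∈KS p-prime (m∣m*n q))
    2d∣6d : 2 * d ℕ.∣ 6 * d
    2d∣6d = divides 3 (polynomial e)
      where polynomial : ∀ e → 6 * suc e ≡ 3 * (2 * suc e)
            polynomial = solve-∀

  β₁-formula : (2 * p + q ∸ 1) / 2 ≡ β₁
  β₁-formula = trans (cong (λ x → (x ∸ 1) / 2) (polynomial a e)) (m*n/n≡m β₁ 2)
    where polynomial : ∀ a e → 2 * suc a + (2 * suc a + 2 * e + 1) ≡ suc ((2 * suc a + e) * 2)
          polynomial = solve-∀

  β₂-formula : + (q + 1) - + p ≡ + β₂
  β₂-formula = trans (cong (λ x → + x - + p) (polynomial a e)) (+-difference p β₂)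
    where polynomial : ∀ a e → 2 * suc a + 2 * e + 1 + 1 ≡ suc a + (suc a + 2 * suc e)
          polynomial = solve-∀

  β₃-formula : + (3 * q + 3) - + (5 * p) ≡ + β₃
  β₃-formula = trans (cong (λ x → + x - + (5 * p)) (polynomial a e)) (+-difference (5 * p) β₃)
    where polynomial : ∀ a e → 3 * (2 * suc a + 2 * e + 1) + 3 ≡ 5 * suc a + (suc a + 6 * suc e)
          polynomial = solve-∀

  proposition : (InZKS (+ ((2 * p + q ∸ 1) / 2)) N ⇔ InZKS (+ (q + 1) - + p) N)
                × (InZKS (+ (3 * q + 3) - + (5 * p)) N → InZKS (+ (q + 1) - + p) N)
  proposition rewrite β₁-formula | β₂-formula | β₃-formula =
    ⇔.trans β₁-membership (⇔.trans d∣q·a⇔d∣p·[p+e] (⇔.sym β₂-membership)) ,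
    λ β₃∈KS → from β₂-membership (β₃-membership β₃∈KS)

proposition3p1 : (p q : ℕ) → Prime p → Prime q → p < q →
    2 * p < q → q < 3 * p →
    (InZKS (+ ((2 * p + q ∸ 1) / 2)) (p * q) ⇔ InZKS (+ (q + 1) - + p) (p * q))
    × (InZKS (+ (3 * q + 3) - + (5 * p)) (p * q) → InZKS (+ (q + 1) - + p) (p * q))
proposition3p1 zero q p-prime = ⊥-elim (¬prime[0] p-prime)
proposition3p1 (suc a) q p-prime q-prime _ 2p<q q<3p
  with odd-excess (s≤s z≤n) q-prime 2p<q q<3p
... | e , refl , d<p = Coordinates.proposition a e p-prime q-prime d<p
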